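{- For $n, k \in \mathbb{N}$ define $$d_{n,k} := \mathrm{lcm}\Big\{ i_1 i_2 \cdots i_k \;;\; i_1, \dots, i_k \in \mathbb{N}^*,\ i_1 + i_2 + \dots + i_k \le n + k \Big\}.$$ Then for all $n, k \in \mathbb{N}$, $d_{n,k}$ divides $d_{n,k+1}$. If moreover $k \ge n$, then $d_{n,k} = d_{n,n}$.
   Context: $\mathbb{N} = \{0,1,2,\dots\}$, $\mathbb{N}^* = \{1,2,\dots\}$. For $k = 0$ the set consists of the empty product $1$, so $d_{n,0} = 1$. -}

module Defs where

open import Data.Nat using (ℕ; zero; suc; _+_; _*_; _≤?_)
open import Data.Nat.LCM using (lcm)
open import Data.List using (List; []; _∷_; map; concatMap; filter; foldr; upTo)
open import Data.Nat.ListAction using (sum; product)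

tuples : ℕ → ℕ → List (List ℕ)
tuples m zero    = [] ∷ []
tuples m (suc k) = concatMap (λ i → map (suc i ∷_) (tuples m k)) (upTo m)

-- All k-tuples (i₁,…,i_k) of positive naturals with i₁ + … + i_k ≤ n + k.
-- (Each entry is automatically ≤ n + k, so enumerating {1..n+k}^k is exhaustive.)
admissible : ℕ → ℕ → List (List ℕ)
admissible n k = filter (λ is → sum is ≤? n + k) (tuples (n + k) k)

lcmList : List ℕ → ℕ
lcmList = foldr lcm 1

d : ℕ → ℕ → ℕ
d n k = lcmList (map product (admissible n k))

-- Prepending an entry 1 to an admissible k-tuple gives an admissible (k+1)-tuple with the
-- same product, so every product counted by d_{n,k} is counted by d_{n,k+1}.  Conversely,
-- when k ≥ n an admissible (k+1)-tuple has sum at most n + k + 1 < 2(k+1), so not all of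
-- its entries are ≥ 2; deleting an entry 1 gives an admissible k-tuple with the same
-- product.
module Submission where

open import Defs
open import Data.Nat using (ℕ; zero; suc; _+_; _*_; _≤_; _<_; z≤n; s≤s; _≤?_; _≤′_; ≤′-refl; ≤′-step)
open import Data.Nat.Properties
open import Data.Nat.Divisibility using (_∣_; ∣-trans; ∣-antisym; 1∣_)
open import Data.Nat.LCM using (m∣lcm[m,n]; n∣lcm[m,n]; lcm-least)
open import Data.Nat.ListAction using (sum; product)
open import Data.Nat.ListAction.Properties using (sum-↭; product-↭)
open import Data.List using (List; []; _∷_; _++_; length; map; upTo)
open import Data.List.Relation.Unary.All as All using (All; []; _∷_)
open import Data.List.Relation.Unary.Any using (here; there; satisfied)
open import Data.List.Membership.Propositional using (_∈_; lose)
open import Data.List.Membership.Propositional.Properties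
  using (∈-map⁺; ∈-map⁻; ∈-concatMap⁺; ∈-concatMap⁻; ∈-upTo⁺; ∈-filter⁺; ∈-filter⁻; ∈-∃++)
open import Data.List.Relation.Binary.Permutation.Propositional using (_↭_)
open import Data.List.Relation.Binary.Permutation.Propositional.Properties
  using (shift; ↭-length; All-resp-↭)
open import Data.Product using (_×_; ∃; _,_)
open import Data.Sum as Sum using (_⊎_; inj₁; inj₂)
open import Relation.Nullary using (contradiction)
open import Relation.Binary.PropositionalEquality using (_≡_; refl; sym; trans; cong; subst)

∈⇒∣lcmList : ∀ {x xs} → x ∈ xs → x ∣ lcmList xs
∈⇒∣lcmList {xs = y ∷ ys} (here refl) = m∣lcm[m,n] y (lcmList ys)
∈⇒∣lcmList {xs = y ∷ ys} (there x∈) = ∣-trans (∈⇒∣lcmList x∈) (n∣lcm[m,n] y (lcmList ys))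

lcmList-least : ∀ {m} xs → (∀ {x} → x ∈ xs → x ∣ m) → lcmList xs ∣ m
lcmList-least []       _    = 1∣ _
lcmList-least (x ∷ xs) all∣ = lcm-least (all∣ (here refl)) (lcmList-least xs (λ y∈ → all∣ (there y∈)))

All-≤-sum : ∀ is → All (_≤ sum is) is
All-≤-sum []       = []
All-≤-sum (i ∷ is) = m≤m+n i (sum is) ∷ All.map (λ i≤ → ≤-trans i≤ (m≤n+m (sum is) i)) (All-≤-sum is)

∈⇒↭ : ∀ {A : Set} {x : A} {xs} → x ∈ xs → ∃ λ ys → xs ↭ x ∷ ys
∈⇒↭ x∈ with ys , zs , refl ← ∈-∃++ x∈ = ys ++ zs , shift _ ys zs

All[2≤]⇒2*length≤sum : ∀ {is} → All (2 ≤_) is → 2 * length is ≤ sum is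
All[2≤]⇒2*length≤sum []                   = z≤n
All[2≤]⇒2*length≤sum {i ∷ is} (2≤i ∷ 2≤is) =
  subst (_≤ i + sum is) (sym (*-suc 2 (length is))) (+-mono-≤ 2≤i (All[2≤]⇒2*length≤sum 2≤is))

1∈⊎All[2≤] : ∀ {is} → All (1 ≤_) is → 1 ∈ is ⊎ All (2 ≤_) is
1∈⊎All[2≤] []                             = inj₂ []
1∈⊎All[2≤] {suc zero ∷ is}    (_ ∷ _)    = inj₁ (here refl)
1∈⊎All[2≤] {suc (suc i) ∷ is} (_ ∷ 1≤is) = Sum.map there (s≤s (s≤s z≤n) ∷_) (1∈⊎All[2≤] 1≤is)

sum<2*length⇒1∈ : ∀ {is} → All (1 ≤_) is → sum is < 2 * length is → 1 ∈ is
sum<2*length⇒1∈ pos sum< with 1∈⊎All[2≤] pos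
... | inj₁ 1∈ = 1∈
... | inj₂ 2≤ = contradiction (All[2≤]⇒2*length≤sum 2≤) (<⇒≱ sum<)

∈-tuples⁺ : ∀ m {is} → All (λ i → 1 ≤ i × i ≤ m) is → is ∈ tuples m (length is)
∈-tuples⁺ m []                                = here refl
∈-tuples⁺ m {suc j ∷ is} ((_ , j<m) ∷ bounds) =
  ∈-concatMap⁺ (λ i → map (suc i ∷_) (tuples m (length is)))
    (lose (∈-upTo⁺ j<m) (∈-map⁺ (suc j ∷_) (∈-tuples⁺ m bounds)))

∈-tuples⁻ : ∀ m k {is} → is ∈ tuples m k → length is ≡ k × All (1 ≤_) is
∈-tuples⁻ m zero    (here refl) = refl , []
∈-tuples⁻ m (suc k) is∈
  with i , is∈′ ← satisfied (∈-concatMap⁻ (λ i → map (suc i ∷_) (tuples m k)) {xs = upTo m} is∈)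
  with js , js∈ , refl ← ∈-map⁻ (suc i ∷_) is∈′
  with len , pos ← ∈-tuples⁻ m k js∈
  = cong suc len , s≤s z≤n ∷ pos

record IsAdmissible (n k : ℕ) (is : List ℕ) : Set where
  constructor mkAdmissible
  field
    length≡  : length is ≡ k
    positive : All (1 ≤_) is
    sum≤     : sum is ≤ n + k

∈-admissible⁺ : ∀ {n k is} → IsAdmissible n k is → is ∈ admissible n k
∈-admissible⁺ {n} {is = is} (mkAdmissible refl pos s) =
  ∈-filter⁺ (λ js → sum js ≤? n + length is)
    (∈-tuples⁺ _ (All.zipWith (λ (p , i≤) → p , ≤-trans i≤ s) (pos , All-≤-sum is))) s

∈-admissible⁻ : ∀ {n k is} → is ∈ admissible n k → IsAdmissible n k is
∈-admissible⁻ {n} {k} is∈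
  with is∈tuples , s ← ∈-filter⁻ (λ js → sum js ≤? n + k) is∈
  with len , pos ← ∈-tuples⁻ _ k is∈tuples
  = mkAdmissible len pos s

d∣d : ∀ {n k k′} →
      (∀ {is} → IsAdmissible n k is → ∃ λ js → IsAdmissible n k′ js × product is ≡ product js) →
      d n k ∣ d n k′
d∣d {n} {k} {k′} realise = lcmList-least (map product (admissible n k)) divides
  where
  divides : ∀ {x} → x ∈ map product (admissible n k) → x ∣ d n k′
  divides x∈
    with is , is∈ , refl ← ∈-map⁻ product x∈
    with js , js-adm , eq ← realise (∈-admissible⁻ is∈)
    rewrite eq = ∈⇒∣lcmList (∈-map⁺ product (∈-admissible⁺ js-adm))

1∷-admissible : ∀ {n k is} → IsAdmissible n k is → IsAdmissible n (suc k) (1 ∷ is)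
1∷-admissible {n} {is = is} (mkAdmissible refl pos s) =
  mkAdmissible refl (s≤s z≤n ∷ pos) (subst (suc (sum is) ≤_) (sym (+-suc n (length is))) (s≤s s))

d∣d-suc : ∀ n k → d n k ∣ d n (suc k)
d∣d-suc n k = d∣d {n} {k} λ adm → _ , 1∷-admissible adm , sym (*-identityˡ _)

1∈-admissible : ∀ {n k is} → n ≤ k → IsAdmissible n (suc k) is → 1 ∈ is
1∈-admissible {n} {k} {is} n≤k (mkAdmissible len pos s) = sum<2*length⇒1∈ pos (begin-strict
    sum is                 ≤⟨ s ⟩
    n + suc k              <⟨ +-monoˡ-< (suc k) (s≤s n≤k) ⟩
    suc k + suc k          ≡⟨ cong (suc k +_) (sym (+-identityʳ (suc k))) ⟩
    2 * suc k              ≡⟨ cong (2 *_) (sym len) ⟩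
    2 * length is          ∎)
  where open ≤-Reasoning

remove-1-admissible : ∀ {n k is} → n ≤ k → IsAdmissible n (suc k) is →
                      ∃ λ js → IsAdmissible n k js × product is ≡ product js
remove-1-admissible {n} {k} {is} n≤k adm@(mkAdmissible len pos s)
  with js , is↭1∷js ← ∈⇒↭ (1∈-admissible n≤k adm)
  = js
  , mkAdmissible (suc-injective (trans (sym (↭-length is↭1∷js)) len))
                 (All.tail (All-resp-↭ is↭1∷js pos))
                 (≤-pred sum-bound)
  , trans (product-↭ is↭1∷js) (*-identityˡ _)
  where
  open ≤-Reasoning

  sum-bound : suc (sum js) ≤ suc (n + k)
  sum-bound = begin
    suc (sum js)           ≡⟨ sym (sum-↭ is↭1∷js) ⟩
    sum is                 ≤⟨ s ⟩
    n + suc k              ≡⟨ +-suc n k ⟩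
    suc (n + k)            ∎

d-suc∣d : ∀ {n k} → n ≤ k → d n (suc k) ∣ d n k
d-suc∣d {n} {k} n≤k = d∣d {n} {suc k} (remove-1-admissible n≤k)

d-stable : ∀ {n k} → n ≤′ k → d n k ≡ d n n
d-stable ≤′-refl              = refl
d-stable {n} (≤′-step {k} n≤′k) =
  trans (∣-antisym (d-suc∣d (≤′⇒≤ n≤′k)) (d∣d-suc n k)) (d-stable n≤′k)

proposition1 : (∀ (n k : ℕ) → d n k ∣ d n (suc k))
                 × (∀ (n k : ℕ) → n ≤ k → d n k ≡ d n n)
proposition1 = d∣d-suc , λ n k n≤k → d-stable (≤⇒≤′ n≤k)
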